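{- For every sequence $s$, $\mathsf{Seq}\vdash\forall x\,\big[x\sqsubseteq\overline{s}\leftrightarrow\bigvee_{t\in I(s)}x=\overline{t}\big]$, where $I(s)$ is the (finite) set of all initial segments of $s$.
   Context: Language $\{e,\ \vdash,\ \circ\}$: $e$ constant, $\vdash$ and $\circ$ binary function symbols ($x\vdash y$ is a term, not provability). $\mathsf{Seq}$ has axioms: $\mathsf{Seq}_1$: $\forall x y\, [x\vdash y\neq e]$; $\mathsf{Seq}_2$: $\forall x_1x_2y_1y_2\,[x_1\vdash x_2=y_1\vdash y_2\rightarrow (x_1=y_1\wedge x_2=y_2)]$; $\mathsf{Seq}_3$: $\forall x\,[x\circ e=x]$; $\mathsf{Seq}_4$: $\forall xyz\,[x\circ(y\vdash z)=(x\circ y)\vdash z]$; $\mathsf{Seq}_5$: $\forall x\,[x=e\vee\exists yz\,[x=y\vdash z]]$. Sequences: $()$ is a sequence, and if $s_1,\dots,s_n$ ($n>0$) are sequences then $(s_1,\dots,s_n)$ is a sequence; an initial segment of $(s_1,\dots,s_n)$ is $(s_1,\dots,s_k)$ for $0\le k\le n$. The sequeral $\overline{s}$ is the closed term with $\overline{()}=e$ and $\overline{(s_1,\dots,s_n)}=(\cdots((e\vdash\overline{s_1})\vdash\overline{s_2})\cdots)\vdash\overline{s_n}$. $x\sqsubseteq t$ abbreviates $\exists y[x\circ y=t]$. -}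

module Defs where

open import Level using (Level; suc)
open import Data.List using (List; []; _∷_; inits; map)
open import Data.List.Relation.Unary.Any using (Any)
open import Data.Product using (∃; _×_)
open import Data.Sum using (_⊎_)
open import Relation.Nullary using (¬_)
open import Relation.Binary.PropositionalEquality using (_≡_)

data Sq : Set where
  node : List Sq → Sq

I : Sq → List Sq
I (node ss) = map node (inits ss)

data Term : Set where
  e   : Term
  _⊢_ : Term → Term → Term
  _∘_ : Term → Term → Term

-- Sequerals: ‾() = e, ‾(s₁,…,sₙ) = (⋯((e ⊢ ‾s₁) ⊢ ‾s₂)⋯) ⊢ ‾sₙ.
mutual
  sequeral : Sq → Term
  sequeral (node ss) = sequeralFrom e ss

  sequeralFrom : Term → List Sq → Term
  sequeralFrom acc []       = acc
  sequeralFrom acc (t ∷ ts) = sequeralFrom (acc ⊢ sequeral t) ts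

-- A structure for the language {e, ⊢, ∘} (equality interpreted as identity).
record Structure (ℓ : Level) : Set (suc ℓ) where
  field
    Carrier : Set ℓ
    eᴹ      : Carrier
    _⊢ᴹ_    : Carrier → Carrier → Carrier
    _∘ᴹ_    : Carrier → Carrier → Carrier

  ⟦_⟧ : Term → Carrier
  ⟦ e ⟧     = eᴹ
  ⟦ t ⊢ u ⟧ = ⟦ t ⟧ ⊢ᴹ ⟦ u ⟧
  ⟦ t ∘ u ⟧ = ⟦ t ⟧ ∘ᴹ ⟦ u ⟧

  _⊑_ : Carrier → Carrier → Set ℓ
  x ⊑ t = ∃ λ y → (x ∘ᴹ y) ≡ t

record IsSeqModel {ℓ : Level} (M : Structure ℓ) : Set ℓ where
  open Structure M
  field
    seq₁ : ∀ x y → ¬ ((x ⊢ᴹ y) ≡ eᴹ)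
    seq₂ : ∀ x₁ x₂ y₁ y₂ → (x₁ ⊢ᴹ x₂) ≡ (y₁ ⊢ᴹ y₂) → (x₁ ≡ y₁) × (x₂ ≡ y₂)
    seq₃ : ∀ x → (x ∘ᴹ eᴹ) ≡ x
    seq₄ : ∀ x y z → (x ∘ᴹ (y ⊢ᴹ z)) ≡ ((x ∘ᴹ y) ⊢ᴹ z)
    seq₅ : ∀ x → (x ≡ eᴹ) ⊎ (∃ λ y → ∃ λ z → x ≡ (y ⊢ᴹ z))

{-# OPTIONS --safe #-}
module Submission where

-- By Seq₅ a witness y of x ⊑ t is either e or u ⊢ v. In the first case x = t by
-- Seq₃; in the second Seq₄ rewrites x ∘ (u ⊢ v) to (x ∘ u) ⊢ v, which rules out
-- t = e by Seq₁ and, for t = a ⊢ b, gives x ⊑ a by Seq₂. Hence the only element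
-- below e is e, and the elements below a ⊢ b are a ⊢ b and those below a.
-- Unwinding the left-nested sequeral of (s₁,…,sₙ) along this recursion yields
-- exactly the sequerals of its initial segments.

open import Defs
open import Data.List using (List; []; _∷_; inits)
open import Data.List.Relation.Unary.Any using (Any; here; there)
open import Data.List.Relation.Unary.Any.Properties using (map⁺; map⁻)
open import Data.Product using (_×_; _,_; proj₁)
open import Data.Sum using (_⊎_; inj₁; inj₂)
open import Data.Empty using (⊥-elim)
open import Relation.Binary.PropositionalEquality using (_≡_; refl; sym; trans; cong)

module SeqModel {ℓ} {M : Structure ℓ} (isSeqModel : IsSeqModel M) where
  open Structure M
  open IsSeqModel isSeqModel

  ⊑-refl : ∀ x → x ⊑ x
  ⊑-refl x = eᴹ , seq₃ x

  ⊑-⊢ʳ : ∀ {x a} b → x ⊑ a → x ⊑ (a ⊢ᴹ b)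
  ⊑-⊢ʳ {x} b (y , x∘y≡a) = y ⊢ᴹ b , trans (seq₄ x y b) (cong (_⊢ᴹ b) x∘y≡a)

  ⊑e⇒≡e : ∀ {x} → x ⊑ eᴹ → x ≡ eᴹ
  ⊑e⇒≡e {x} (y , x∘y≡e) with seq₅ y
  ... | inj₁ refl          = trans (sym (seq₃ x)) x∘y≡e
  ... | inj₂ (u , v , refl) = ⊥-elim (seq₁ _ _ (trans (sym (seq₄ x u v)) x∘y≡e))

  ⊑-⊢⁻ : ∀ {x a b} → x ⊑ (a ⊢ᴹ b) → x ⊑ a ⊎ x ≡ (a ⊢ᴹ b)
  ⊑-⊢⁻ {x} (y , x∘y≡a⊢b) with seq₅ y
  ... | inj₁ refl          = inj₂ (trans (sym (seq₃ x)) x∘y≡a⊢b)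
  ... | inj₂ (u , v , refl) = inj₁ (u , proj₁ (seq₂ _ _ _ _ (trans (sym (seq₄ x u v)) x∘y≡a⊢b)))

  IsInitialSequeralFrom : Carrier → Term → List Sq → Set ℓ
  IsInitialSequeralFrom x a ts = Any (λ ps → x ≡ ⟦ sequeralFrom a ps ⟧) (inits ts)

  ⊑-sequeralFromʳ : ∀ {x a} ts → x ⊑ ⟦ a ⟧ → x ⊑ ⟦ sequeralFrom a ts ⟧
  ⊑-sequeralFromʳ []       x⊑a = x⊑a
  ⊑-sequeralFromʳ (t ∷ ts) x⊑a = ⊑-sequeralFromʳ ts (⊑-⊢ʳ ⟦ sequeral t ⟧ x⊑a)

  initialSequeralFrom⇒⊑ : ∀ {x} a ts → IsInitialSequeralFrom x a ts → x ⊑ ⟦ sequeralFrom a ts ⟧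
  initialSequeralFrom⇒⊑ {x} a ts        (here refl) = ⊑-sequeralFromʳ ts (⊑-refl x)
  initialSequeralFrom⇒⊑     a (t ∷ ts) (there p)   = initialSequeralFrom⇒⊑ (a ⊢ sequeral t) ts (map⁻ p)

  ⊑-sequeralFrom⇒initial : ∀ {x} a ts → x ⊑ ⟦ sequeralFrom a ts ⟧ → x ⊑ ⟦ a ⟧ ⊎ IsInitialSequeralFrom x a ts
  ⊑-sequeralFrom⇒initial a []       x⊑a = inj₁ x⊑a
  ⊑-sequeralFrom⇒initial a (t ∷ ts) x⊑s with ⊑-sequeralFrom⇒initial (a ⊢ sequeral t) ts x⊑s
  ... | inj₂ p    = inj₂ (there (map⁺ p))
  ... | inj₁ x⊑a⊢t with ⊑-⊢⁻ x⊑a⊢t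
  ...   | inj₁ x⊑a   = inj₁ x⊑a
  ...   | inj₂ x≡a⊢t = inj₂ (there (here x≡a⊢t))

lemma2 : ∀ {ℓ} (M : Structure ℓ) → IsSeqModel M → (s : Sq) → (x : Structure.Carrier M)
    → (Structure._⊑_ M x (Structure.⟦_⟧ M (sequeral s)) → Any (λ t → x ≡ Structure.⟦_⟧ M (sequeral t)) (I s))
    × (Any (λ t → x ≡ Structure.⟦_⟧ M (sequeral t)) (I s) → Structure._⊑_ M x (Structure.⟦_⟧ M (sequeral s)))
lemma2 M isSeqModel (node ss) x = only-initial , initial-⊑
  where
  open Structure M
  open SeqModel isSeqModel

  only-initial : x ⊑ ⟦ sequeral (node ss) ⟧ → Any (λ t → x ≡ ⟦ sequeral t ⟧) (I (node ss))
  only-initial x⊑s with ⊑-sequeralFrom⇒initial e ss x⊑s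
  ... | inj₁ x⊑e = map⁺ (here (⊑e⇒≡e x⊑e))
  ... | inj₂ p   = map⁺ p

  initial-⊑ : Any (λ t → x ≡ ⟦ sequeral t ⟧) (I (node ss)) → x ⊑ ⟦ sequeral (node ss) ⟧
  initial-⊑ p = initialSequeralFrom⇒⊑ e ss (map⁻ p)
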